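{- Let $X_1\to Y_1,\ldots,X_k\to Y_k$ be partial implications on $[n]$ with $k\ge1$. If there exist a partial implication $X_0\to Y_0$ and a $\gamma\in(0,1)$ such that the entailment $X_1\to Y_1,\ldots,X_k\to Y_k\models_\gamma X_0\to Y_0$ holds properly, then $X_1\to Y_1,\ldots,X_k\to Y_k$ enforces homogeneity.
   Context: Attributes are the elements of $[n]$; a transaction is a subset of $[n]$; a data-set is a finite multiset of transactions; $\mathrm{C}_{\mathcal D}[X]$ counts transactions of $\mathcal D$ containing $X$ with multiplicity. A partial implication $X\to Y$ is a pair of subsets of $[n]$; $XY=X\cup Y$. $\mathcal D\models_\gamma X\to Y$ means $\mathrm{C}_{\mathcal D}[X]=0$ or $\mathrm{C}_{\mathcal D}[XY]/\mathrm{C}_{\mathcal D}[X]\ge\gamma$. For a set $\Sigma$ of partial implications, $\Sigma\models_\gamma X_0\to Y_0$ means every data-set satisfying all members of $\Sigma$ at $\gamma$ satisfies $X_0\to Y_0$ at $\gamma$; it holds properly if it holds and fails for every proper subset of $\Sigma$. A set $X_1\to Y_1,\ldots,X_k\to Y_k$ enforces homogeneity if for every $Z\subseteq[n]$: if for all $i\in[k]$ either $X_i\not\subseteq Z$ or $X_iY_i\subseteq Z$, then either $X_i\not\subseteq Z$ for all $i\in[k]$, or $X_iY_i\subseteq Z$ for all $i\in[k]$.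
   Formalization: The parameter γ ranges only over the rationals in $(0,1)$ rather than over the whole real interval $(0,1)$. -}

module Defs where

open import Data.Nat using (ℕ; suc; _≤_)
open import Data.Fin using (Fin)
open import Data.Fin.Subset using (Subset; _⊆_; _∪_; _∈_)
open import Data.Fin.Subset.Properties using (_⊆?_)
open import Data.List using (List; length; filter)
open import Data.Product using (_×_; _,_; Σ; ∃)
open import Data.Sum using (_⊎_)
open import Data.Integer using (+_)
open import Data.Rational using (ℚ; _/_; _*_) renaming (_≤_ to _≤ℚ_; _<_ to _<ℚ_)
open import Relation.Nullary using (¬_)
open import Relation.Binary.PropositionalEquality using (_≡_)

Transaction : ℕ → Set
Transaction n = Subset n

-- data-set: finite multiset of transactions, represented as a list
DataSet : ℕ → Set
DataSet n = List (Transaction n)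

record PI (n : ℕ) : Set where
  constructor _⇒_
  field
    lhs : Subset n
    rhs : Subset n
open PI public

C : ∀ {n} → DataSet n → Subset n → ℕ
C D X = length (filter (X ⊆?_) D)

toℚ : ℕ → ℚ
toℚ m = (+ m) / 1

-- D ⊨_γ X → Y :  C[X] = 0  or  C[XY]/C[X] ≥ γ  (i.e. γ·C[X] ≤ C[XY])
_⊨[_]_ : ∀ {n} → DataSet n → ℚ → PI n → Set
D ⊨[ γ ] (X ⇒ Y) = (C D X ≡ 0) ⊎ (γ * toℚ (C D X) ≤ℚ toℚ (C D (X ∪ Y)))

Entails : ∀ {n k} → (Fin k → PI n) → Subset k → ℚ → PI n → Set
Entails {n} Σ' P γ φ =
  (D : DataSet n) → (∀ i → i ∈ P → D ⊨[ γ ] Σ' i) → D ⊨[ γ ] φ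

-- the index set P describes a proper subset of the SET {Σ i | i ∈ Fin k}:
-- some member Σ j of the set is not of the form Σ i with i ∈ P
ProperSub : ∀ {n k} → (Fin k → PI n) → Subset k → Set
ProperSub Σ' P = ∃ λ j → ∀ i → i ∈ P → ¬ (Σ' i ≡ Σ' j)

EntailsProperly : ∀ {n k} → (Fin k → PI n) → ℚ → PI n → Set
EntailsProperly {k = k} Σ' γ φ =
  (∀ D → (∀ i → D ⊨[ γ ] Σ' i) → D ⊨[ γ ] φ) ×
  (∀ P → ProperSub Σ' P → ¬ Entails Σ' P γ φ)

EnforcesHomogeneity : ∀ {n k} → (Fin k → PI n) → Set
EnforcesHomogeneity {n} Σ' =
  (Z : Subset n) →
  (∀ i → ¬ (lhs (Σ' i) ⊆ Z) ⊎ (lhs (Σ' i) ∪ rhs (Σ' i)) ⊆ Z) →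
  (∀ i → ¬ (lhs (Σ' i) ⊆ Z)) ⊎ (∀ i → (lhs (Σ' i) ∪ rhs (Σ' i)) ⊆ Z)

{-# OPTIONS --safe #-}
-- Let Z be closed under the premises read as Horn clauses, and suppose Z contains the
-- antecedent of some premise but not of another. If X₀Y₀ ⊆ Z, intersecting every
-- transaction with Z empties the premises whose antecedent leaves Z and keeps the counts
-- of all other premises and of X₀ → Y₀, so the premises with antecedent inside Z already
-- entail X₀ → Y₀. Otherwise write γ = p/(d+1) with p ≤ d and add d·|D| copies of Z: the
-- premises with antecedent inside Z then hold with confidence at least d/(d+1), the others
-- and the count of X₀Y₀ are untouched, and the count of X₀ only grows, so the premises with
-- antecedent outside Z already entail X₀ → Y₀. Either way properness is contradicted.
module Submission where

open import Defs
open import Data.Nat as ℕ using (ℕ; suc; _+_; _*_; _≤_)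
open import Data.Fin using (Fin)
open import Data.Product using (_×_; ∃₂; _,_)
open import Data.Rational using (ℚ; 0ℚ; 1ℚ; mkℚ; *<*; toℚᵘ; positive)
  renaming (_<_ to _<ℚ_; _≤_ to _≤ℚ_; _*_ to _*ℚ_)

open import Data.Bool using (true)
open import Data.Bool.Properties using (T-≡)
open import Data.Empty using (⊥; ⊥-elim)
open import Data.Fin.Subset using (Subset; _⊆_; _∪_; _∩_; _∈_; ∁)
open import Data.Fin.Subset.Properties
  using (_⊆?_; p⊆p∪q; p∩q⊆p; p∩q⊆q; x∈p∩q⁺; ⊆-trans; x∈∁p⇒x∉p; x∉p⇒x∈∁p)
import Data.Fin.Properties as Fin
open import Data.Integer as ℤ using (Positive)
import Data.Integer.Properties as ℤ
open import Data.List using ([]; _∷_; _++_; replicate; length; filter; map)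
import Data.List.Properties as List
open import Data.List.Relation.Unary.All using (universal)
open import Data.List.Relation.Unary.All.Properties using (replicate⁺; map⁺)
open import Data.Nat.Coprimality using (Coprime)
import Data.Nat.Properties as ℕ
open import Data.Nat.Solver using (module +-*-Solver)
import Data.Rational.Properties as ℚ
open import Data.Rational.Unnormalised as ℚᵘ using (mkℚᵘ; *≤*)
import Data.Rational.Unnormalised.Properties as ℚᵘ
open import Data.Sum using (_⊎_; inj₁; inj₂; [_,_]′)
open import Data.Vec using (tabulate; lookup)
import Data.Vec.Properties as Vec
open import Function using (_∘_; id; _⇔_; mk⇔; Equivalence)
open import Relation.Binary.PropositionalEquality
  using (_≡_; refl; sym; trans; cong; subst; subst₂; module ≡-Reasoning)
open import Relation.Nullary using (¬_; does; yes; no)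
open import Relation.Nullary.Decidable using (toSum; toWitness; isYes; isYes≗does; dec-true)
open import Relation.Unary using (Pred; Decidable)

ConfidenceAtLeast : ℚ → ℕ → ℕ → Set
ConfidenceAtLeast γ a b = (a ≡ 0) ⊎ (γ *ℚ toℚ a ≤ℚ toℚ b)

toℚᵘ-toℚ : ∀ m → toℚᵘ (toℚ m) ℚᵘ.≃ mkℚᵘ (ℤ.+ m) 0
toℚᵘ-toℚ m = ℚ.toℚᵘ-fromℚᵘ (mkℚᵘ (ℤ.+ m) 0)

module _ {p d : ℕ} .{c : Coprime p (suc d)} where

  private
    γ : ℚ
    γ = mkℚ (ℤ.+ p) d c

  *-toℚ-≤-toℚ⇔ : ∀ a b → (γ *ℚ toℚ a ≤ℚ toℚ b) ⇔ (p * a ≤ b * suc d)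
  *-toℚ-≤-toℚ⇔ a b = mk⇔
    (λ γa≤b → from-ℚᵘ (ℚᵘ.≤-respʳ-≃ (toℚᵘ-toℚ b) (ℚᵘ.≤-respˡ-≃ toℚᵘ-γa (ℚ.toℚᵘ-mono-≤ γa≤b))))
    (λ pa≤bd → ℚ.toℚᵘ-cancel-≤
      (ℚᵘ.≤-respˡ-≃ (ℚᵘ.≃-sym toℚᵘ-γa) (ℚᵘ.≤-respʳ-≃ (ℚᵘ.≃-sym (toℚᵘ-toℚ b)) (to-ℚᵘ pa≤bd))))
    where
    γaᵘ bᵘ : ℚᵘ.ℚᵘ
    γaᵘ = mkℚᵘ (ℤ.+ p) d ℚᵘ.* mkℚᵘ (ℤ.+ a) 0
    bᵘ  = mkℚᵘ (ℤ.+ b) 0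

    toℚᵘ-γa : toℚᵘ (γ *ℚ toℚ a) ℚᵘ.≃ γaᵘ
    toℚᵘ-γa = ℚᵘ.≃-trans (ℚ.toℚᵘ-homo-* γ (toℚ a)) (ℚᵘ.*-congˡ {mkℚᵘ (ℤ.+ p) d} (toℚᵘ-toℚ a))

    lhs≡ : (ℤ.+ p ℤ.* ℤ.+ a) ℤ.* ℤ.+ 1 ≡ ℤ.+ (p * a)
    lhs≡ = trans (ℤ.*-identityʳ _) (sym (ℤ.pos-* p a))

    rhs≡ : ℤ.+ b ℤ.* ℤ.+ (suc d * 1) ≡ ℤ.+ (b * suc d)
    rhs≡ = trans (sym (ℤ.pos-* b (suc d * 1))) (cong (λ e → ℤ.+ (b * e)) (ℕ.*-identityʳ (suc d)))

    from-ℚᵘ : γaᵘ ℚᵘ.≤ bᵘ → p * a ≤ b * suc d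
    from-ℚᵘ (*≤* le) = ℤ.drop‿+≤+ (subst₂ ℤ._≤_ lhs≡ rhs≡ le)

    to-ℚᵘ : p * a ≤ b * suc d → γaᵘ ℚᵘ.≤ bᵘ
    to-ℚᵘ le = *≤* (subst₂ ℤ._≤_ (sym lhs≡) (sym rhs≡) (ℤ.+≤+ le))

  <1⇒numerator≤denominator-1 : γ <ℚ 1ℚ → p ≤ d
  <1⇒numerator≤denominator-1 (*<* p<1+d) =
    ℕ.≤-pred (ℤ.drop‿+<+ (subst₂ ℤ._<_ (ℤ.*-identityʳ _) (ℤ.*-identityˡ _) p<1+d))

  confidence-mono : ∀ {a a′ b b′} → a ≤ a′ → b′ ≤ b →
    ConfidenceAtLeast γ a′ b′ → ConfidenceAtLeast γ a b
  confidence-mono a≤a′ _ (inj₁ refl) = inj₁ (ℕ.n≤0⇒n≡0 a≤a′)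
  confidence-mono {a} {a′} {b} {b′} a≤a′ b′≤b (inj₂ γa′≤b′) =
    inj₂ (Equivalence.from (*-toℚ-≤-toℚ⇔ a b) (begin
      p * a       ≤⟨ ℕ.*-monoʳ-≤ p a≤a′ ⟩
      p * a′      ≤⟨ Equivalence.to (*-toℚ-≤-toℚ⇔ a′ b′) γa′≤b′ ⟩
      b′ * suc d  ≤⟨ ℕ.*-monoˡ-≤ (suc d) b′≤b ⟩
      b * suc d   ∎))
    where open ℕ.≤-Reasoning

  confidence-pad : p ≤ d → ∀ {a L} b → a ≤ L → ConfidenceAtLeast γ (a + d * L) (b + d * L)
  confidence-pad p≤d {a} {L} b a≤L =
    inj₂ (Equivalence.from (*-toℚ-≤-toℚ⇔ (a + d * L) (b + d * L)) (begin
      p * (a + d * L)      ≤⟨ ℕ.*-mono-≤ p≤d (ℕ.+-monoˡ-≤ (d * L) a≤L) ⟩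
      d * (suc d * L)      ≡⟨ solve 2 (λ d L → d :* ((con 1 :+ d) :* L) := d :* L :* (con 1 :+ d)) refl d L ⟩
      d * L * suc d        ≤⟨ ℕ.*-monoˡ-≤ (suc d) (ℕ.m≤n+m (d * L) b) ⟩
      (b + d * L) * suc d  ∎))
    where
    open ℕ.≤-Reasoning
    open +-*-Solver

module _ {n : ℕ} where

  C-++ : ∀ (D E : DataSet n) X → C (D ++ E) X ≡ C D X + C E X
  C-++ D E X = trans (cong length (List.filter-++ (X ⊆?_) D E)) (List.length-++ (filter (X ⊆?_) D))

  C-replicate-⊆ : ∀ {X Z : Subset n} N → X ⊆ Z → C (replicate N Z) X ≡ N
  C-replicate-⊆ {X} N X⊆Z =
    trans (cong length (List.filter-all (X ⊆?_) (replicate⁺ N X⊆Z))) (List.length-replicate N)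

  C-replicate-⊈ : ∀ {X Z : Subset n} N → ¬ X ⊆ Z → C (replicate N Z) X ≡ 0
  C-replicate-⊈ {X} N X⊈Z = cong length (List.filter-none (X ⊆?_) (replicate⁺ N X⊈Z))

  C-++-replicate-⊆ : ∀ {X Z : Subset n} D N → X ⊆ Z → C (D ++ replicate N Z) X ≡ C D X + N
  C-++-replicate-⊆ {X} D N X⊆Z = trans (C-++ D _ X) (cong (C D X +_) (C-replicate-⊆ N X⊆Z))

  C-++-replicate-⊈ : ∀ {X Z : Subset n} D N → ¬ X ⊆ Z → C (D ++ replicate N Z) X ≡ C D X
  C-++-replicate-⊈ {X} D N X⊈Z =
    trans (C-++ D _ X) (trans (cong (C D X +_) (C-replicate-⊈ N X⊈Z)) (ℕ.+-identityʳ (C D X)))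

  C-map-∩-⊆ : ∀ {X Z : Subset n} (D : DataSet n) → X ⊆ Z → C (map (_∩ Z) D) X ≡ C D X
  C-map-∩-⊆ [] _ = refl
  C-map-∩-⊆ {X} {Z} (T ∷ D) X⊆Z with X ⊆? T | X ⊆? (T ∩ Z)
  ... | yes _   | yes _      = cong suc (C-map-∩-⊆ D X⊆Z)
  ... | no _    | no _       = C-map-∩-⊆ D X⊆Z
  ... | yes X⊆T | no X⊈T∩Z   = ⊥-elim (X⊈T∩Z (λ x∈X → x∈p∩q⁺ (X⊆T x∈X , X⊆Z x∈X)))
  ... | no X⊈T  | yes X⊆T∩Z  = ⊥-elim (X⊈T (⊆-trans X⊆T∩Z (p∩q⊆p T Z)))

  C-map-∩-⊈ : ∀ {X Z : Subset n} (D : DataSet n) → ¬ X ⊆ Z → C (map (_∩ Z) D) X ≡ 0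
  C-map-∩-⊈ {X} {Z} D X⊈Z = cong length (List.filter-none (X ⊆?_)
    (map⁺ (universal (λ T (X⊆T∩Z : X ⊆ T ∩ Z) → X⊈Z (⊆-trans X⊆T∩Z (p∩q⊆q T Z))) D)))

select : ∀ {ℓ k} {P : Pred (Fin k) ℓ} → Decidable P → Subset k
select P? = tabulate (does ∘ P?)

module _ {ℓ k} {P : Pred (Fin k) ℓ} (P? : Decidable P) {i : Fin k} where

  ∈-select⁻ : i ∈ select P? → P i
  ∈-select⁻ i∈ = toWitness {a? = P? i} (Equivalence.from T-≡ (begin
    isYes (P? i)          ≡⟨ isYes≗does (P? i) ⟩
    does (P? i)           ≡⟨ Vec.lookup∘tabulate (does ∘ P?) i ⟨
    lookup (select P?) i  ≡⟨ Vec.[]=⇒lookup i∈ ⟩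
    true                  ∎))
    where open ≡-Reasoning

  ∈-select⁺ : P i → i ∈ select P?
  ∈-select⁺ Pi = Vec.lookup⇒[]= i (select P?)
    (trans (Vec.lookup∘tabulate (does ∘ P?) i) (dec-true (P? i) Pi))

properSub-separating : ∀ {ℓ n k} (Σ' : Fin k → PI n) (Q : Pred (PI n) ℓ) {P : Subset k} {j} →
  (∀ i → i ∈ P → Q (Σ' i)) → ¬ Q (Σ' j) → ProperSub Σ' P
properSub-separating Σ' Q P⊨Q ¬Qj = _ , λ i i∈P Σi≡Σj → ¬Qj (subst Q Σi≡Σj (P⊨Q i i∈P))

lhs∪rhs : ∀ {n} → PI n → Subset n
lhs∪rhs r = lhs r ∪ rhs r

EntailsAll : ∀ {n k} → (Fin k → PI n) → ℚ → PI n → Set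
EntailsAll Σ' γ φ = ∀ D → (∀ i → D ⊨[ γ ] Σ' i) → D ⊨[ γ ] φ

Closed : ∀ {n k} → (Fin k → PI n) → Subset n → Set
Closed Σ' Z = ∀ i → ¬ (lhs (Σ' i) ⊆ Z) ⊎ lhs∪rhs (Σ' i) ⊆ Z

Splits : ∀ {n k} → (Fin k → PI n) → Subset n → Set
Splits Σ' Z = ∃₂ λ i j → ¬ lhs (Σ' i) ⊆ Z × lhs (Σ' j) ⊆ Z

closed-dichotomy : ∀ {n k} {Σ' : Fin k → PI n} {Z} → Closed Σ' Z → ¬ Splits Σ' Z →
  (∀ i → ¬ lhs (Σ' i) ⊆ Z) ⊎ (∀ i → lhs∪rhs (Σ' i) ⊆ Z)
closed-dichotomy {Σ' = Σ'} {Z} closed ¬splits with Fin.any? (λ j → lhs (Σ' j) ⊆? Z)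
... | no ∄j          = inj₁ (λ i X⊆Z → ∄j (i , X⊆Z))
... | yes (j , j-in) = inj₂ (λ i → [ (λ i-out → ⊥-elim (¬splits (i , j , i-out , j-in))) , id ]′ (closed i))

premisesInside : ∀ {n k} → (Fin k → PI n) → Subset n → Subset k
premisesInside Σ' Z = select (λ i → lhs (Σ' i) ⊆? Z)

module _ {n k} {Σ' : Fin k → PI n} {Z : Subset n} (closed : Closed Σ' Z) where

  private
    inside? : Decidable (λ i → lhs (Σ' i) ⊆ Z)
    inside? i = lhs (Σ' i) ⊆? Z

  premisesInside-entail : ∀ {γ φ} → lhs∪rhs φ ⊆ Z → EntailsAll Σ' γ φ →
    Entails Σ' (premisesInside Σ' Z) γ φ
  premisesInside-entail {γ} {φ} φ⊆Z entails D D⊨inside =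
    subst₂ (ConfidenceAtLeast γ) (C-map-∩-⊆ D (⊆-trans (p⊆p∪q (rhs φ)) φ⊆Z)) (C-map-∩-⊆ D φ⊆Z)
      (entails (map (_∩ Z) D) D∩Z⊨Σ)
    where
    D∩Z⊨Σ : ∀ i → map (_∩ Z) D ⊨[ γ ] Σ' i
    D∩Z⊨Σ i = [ (λ X⊈Z → inj₁ (C-map-∩-⊈ D X⊈Z)) , inside ]′ (closed i)
      where
      inside : lhs∪rhs (Σ' i) ⊆ Z → map (_∩ Z) D ⊨[ γ ] Σ' i
      inside XY⊆Z = subst₂ (ConfidenceAtLeast γ) (sym (C-map-∩-⊆ D X⊆Z)) (sym (C-map-∩-⊆ D XY⊆Z))
                      (D⊨inside i (∈-select⁺ inside? X⊆Z))
        where X⊆Z = ⊆-trans (p⊆p∪q (rhs (Σ' i))) XY⊆Z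

  module _ {p d : ℕ} .{c : Coprime p (suc d)} {φ : PI n} (p≤d : p ≤ d) where

    private
      γ : ℚ
      γ = mkℚ (ℤ.+ p) d c

    premisesOutside-entail : ¬ lhs∪rhs φ ⊆ Z → EntailsAll Σ' γ φ →
      Entails Σ' (∁ (premisesInside Σ' Z)) γ φ
    premisesOutside-entail φ⊈Z entails D D⊨outside =
      confidence-mono (ℕ.≤-trans (ℕ.m≤m+n _ _) (ℕ.≤-reflexive (sym (C-++ D E (lhs φ)))))
        (ℕ.≤-reflexive (C-++-replicate-⊈ D N φ⊈Z)) (entails (D ++ E) D+E⊨Σ)
      where
      N = d * length D
      E = replicate N Z
      D+E⊨Σ : ∀ i → (D ++ E) ⊨[ γ ] Σ' i
      D+E⊨Σ i = [ outside , inside ]′ (closed i)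
        where
        X⊆XY : lhs (Σ' i) ⊆ lhs∪rhs (Σ' i)
        X⊆XY = p⊆p∪q (rhs (Σ' i))
        outside : ¬ lhs (Σ' i) ⊆ Z → (D ++ E) ⊨[ γ ] Σ' i
        outside X⊈Z = subst₂ (ConfidenceAtLeast γ)
          (sym (C-++-replicate-⊈ D N X⊈Z)) (sym (C-++-replicate-⊈ D N (X⊈Z ∘ ⊆-trans X⊆XY)))
          (D⊨outside i (x∉p⇒x∈∁p (X⊈Z ∘ ∈-select⁻ inside?)))
        inside : lhs∪rhs (Σ' i) ⊆ Z → (D ++ E) ⊨[ γ ] Σ' i
        inside XY⊆Z = subst₂ (ConfidenceAtLeast γ)
          (sym (C-++-replicate-⊆ D N (⊆-trans X⊆XY XY⊆Z))) (sym (C-++-replicate-⊆ D N XY⊆Z))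
          (confidence-pad p≤d (C D (lhs∪rhs (Σ' i))) (List.length-filter (lhs (Σ' i) ⊆?_) D))

    proper⇒¬Splits : EntailsProperly Σ' γ φ → ¬ Splits Σ' Z
    proper⇒¬Splits (entails , minimal) (i , j , i-out , j-in) =
      [ by-restriction , by-padding ]′ (toSum (lhs∪rhs φ ⊆? Z))
      where
      by-restriction : lhs∪rhs φ ⊆ Z → ⊥
      by-restriction φ⊆Z = minimal (premisesInside Σ' Z)
        (properSub-separating Σ' ((_⊆ Z) ∘ lhs) (λ _ → ∈-select⁻ inside?) i-out)
        (premisesInside-entail {γ = γ} φ⊆Z entails)
      by-padding : ¬ lhs∪rhs φ ⊆ Z → ⊥
      by-padding φ⊈Z = minimal (∁ (premisesInside Σ' Z))
        (properSub-separating Σ' (¬_ ∘ (_⊆ Z) ∘ lhs)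
          (λ _ r∈ → x∈∁p⇒x∉p r∈ ∘ ∈-select⁺ inside?) (λ j-out → j-out j-in))
        (premisesOutside-entail φ⊈Z entails)

lemma3 : (n k : ℕ) (Σ' : Fin (suc k) → PI n) →
    ∃₂ (λ (φ : PI n) (γ : ℚ) → (0ℚ <ℚ γ) × (γ <ℚ 1ℚ) × EntailsProperly Σ' γ φ) →
    EnforcesHomogeneity Σ'
lemma3 n k Σ' (φ , mkℚ ℤ.-[1+ _ ] _ _ , 0<γ , _) = ⊥-elim (Positive.pos (positive 0<γ))
lemma3 n k Σ' (φ , mkℚ (ℤ.+ p) d _ , _ , γ<1 , proper) Z closed =
  closed-dichotomy closed (proper⇒¬Splits closed (<1⇒numerator≤denominator-1 γ<1) proper)
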